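{- For every positive integer $k$, every decomposable point set $Q$ is $(k,2)$-Ramsey; that is, there is a point set $P$ such that for every $k$-coloring $c$ of $\binom{P}{2}$ there is a subset $Q'\subseteq P$ such that $Q'$ and $Q$ have the same order type and $\binom{Q'}{2}$ is monochromatic in $c$.
   Context: All point sets are finite planar sets in general position (no three collinear) with pairwise distinct $x$-coordinates. Two point sets $P,Q$ have the same order type if there is a bijection $f\colon P\to Q$ such that every ordered triple of points of $P$ has the same orientation (clockwise or counterclockwise) as its image. A $k$-coloring of a set $X$ is a function from $X$ to a set of size $k$; $\binom{X}{p}$ is the set of $p$-element subsets of $X$. For points $u,v$ with $x(u)<x(v)$, a point $w$ is above the line $\overline{uv}$ if $(u,v,w)$ is counterclockwise and below if clockwise. For point sets $A=\{a_1,\dots\}$, $B=\{b_1,\dots\}$ indexed by increasing $x$-coordinate, $A$ lies deep below $B$ if every point of $B$ lies above every line $\overline{a_ia_j}$ with $i<j$ and every point of $A$ lies below every line $\overline{b_ib_j}$ with $i<j$. We write $x(A)<x(B)$ if every point of $A$ has smaller $x$-coordinate than every point of $B$. A point set $P$ is decomposable if $|P|=1$ or there is a partition $P=P_1\cup P_2$ with $P_1,P_2$ nonempty, $x(P_1)<x(P_2)$, $P_1$ deep below $P_2$, and both $P_1$ and $P_2$ decomposable.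
   Formalization: The decomposable point set Q ranges only over point sets with rational coordinates, and the point set P is likewise taken with rational coordinates. -}

module Defs where

open import Data.Nat using (ℕ)
open import Data.Fin using (Fin) renaming (_<_ to _<ᶠ_)
open import Data.Fin.Subset using (Subset; _∈_; _∪_; Nonempty; ∣_∣)
open import Data.Rational using (ℚ; _*_; _-_; 0ℚ; _<_)
open import Data.Product using (_×_; proj₁; proj₂; Σ)
open import Relation.Binary.PropositionalEquality using (_≡_)
open import Relation.Nullary using (¬_)
open import Function.Definitions using (Injective)
open import Function.Bundles using (_⇔_)

Point : Set
Point = ℚ × ℚ

xc : Point → ℚ
xc = proj₁

yc : Point → ℚ
yc = proj₂

-- Twice the signed area of the triangle (p,q,r); positive iff counterclockwise.
orient : Point → Point → Point → ℚ
orient p q r = ((xc q - xc p) * (yc r - yc p)) - ((yc q - yc p) * (xc r - xc p))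

CCW : Point → Point → Point → Set
CCW p q r = 0ℚ < orient p q r

CW : Point → Point → Point → Set
CW p q r = orient p q r < 0ℚ

record PointSet : Set where
  field
    size : ℕ
    pt : Fin size → Point
    distinctX : ∀ i j → xc (pt i) ≡ xc (pt j) → i ≡ j
    generalPosition : ∀ i j l → ¬ i ≡ j → ¬ j ≡ l → ¬ i ≡ l →
                      ¬ orient (pt i) (pt j) (pt l) ≡ 0ℚ

open PointSet public

module _ (P : PointSet) where

  XBefore : Subset (size P) → Subset (size P) → Set
  XBefore A B = ∀ i j → i ∈ A → j ∈ B → xc (pt P i) < xc (pt P j)

  DeepBelow : Subset (size P) → Subset (size P) → Set
  DeepBelow A B =
    (∀ i j l → i ∈ A → j ∈ A → xc (pt P i) < xc (pt P j) → l ∈ B →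
       CCW (pt P i) (pt P j) (pt P l)) ×
    (∀ i j l → i ∈ B → j ∈ B → xc (pt P i) < xc (pt P j) → l ∈ A →
       CW (pt P i) (pt P j) (pt P l))

  data DecomposableSub : Subset (size P) → Set where
    single : ∀ S → ∣ S ∣ ≡ 1 → DecomposableSub S
    split  : ∀ S S₁ S₂ → Nonempty S₁ → Nonempty S₂ → S₁ ∪ S₂ ≡ S →
             XBefore S₁ S₂ → DeepBelow S₁ S₂ →
             DecomposableSub S₁ → DecomposableSub S₂ → DecomposableSub S

open import Data.Fin.Subset using (⊤)

Decomposable : PointSet → Set
Decomposable P = DecomposableSub P ⊤

SameOrderTypeVia : (Q P : PointSet) → (Fin (size Q) → Fin (size P)) → Set
SameOrderTypeVia Q P g =
  Injective _≡_ _≡_ g ×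
  (∀ i j l → (CCW (pt Q i) (pt Q j) (pt Q l) ⇔ CCW (pt P (g i)) (pt P (g j)) (pt P (g l)))
           × (CW (pt Q i) (pt Q j) (pt Q l) ⇔ CW (pt P (g i)) (pt P (g j)) (pt P (g l))))

-- A k-coloring of the 2-subsets of P: the pair {i,j} with i < j gets colour c i j.
PairColoring : ℕ → PointSet → Set
PairColoring k P = Fin (size P) → Fin (size P) → Fin k

Monochromatic : ∀ {k} (P : PointSet) → PairColoring k P → ∀ {m} → (Fin m → Fin (size P)) → Set
Monochromatic {k} P c g = Σ (Fin k) λ a → ∀ i j → g i <ᶠ g j → c (g i) (g j) ≡ a

module Submission where

-- A decomposition of Q is a binary tree: Q splits into a left part lying
-- deep below a right part, and so on down to single points.  The order type of
-- Q is then determined by the tree alone: a triple inside one part is oriented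
-- as in that part, and a triple meeting both parts is oriented according to the
-- left-to-right order of its two points on the same side (σ below).  So it is
-- enough to find, for the tree s of Q, a point set P drawn from a bigger tree U
-- such that every colouring of pairs of P contains a monochromatic copy of s.
--
-- The theorem draws the Ramsey tree for the
-- shape of Q and pulls a monochromatic copy of that shape back to Q.

open import Defs

module Trees where

  open import Data.Product using (Σ; _,_)
  open import Data.Sum using (_⊎_; inj₁; inj₂)
  open import Relation.Binary.PropositionalEquality using (_≡_; refl; sym; trans; cong; cong₂)

  data Tree : Set where
    leaf : Tree
    node : Tree → Tree → Tree

  -- A copy of s inside t that respects left and right: it either descends into
  -- one subtree of t, or sends the root of s to the root of t and embeds the two
  -- subtrees of s into the two subtrees of t.
  data Emb : Tree → Tree → Set where
    stop : Emb leaf leaf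
    goL  : ∀ {s l r} → Emb s l → Emb s (node l r)
    goR  : ∀ {s l r} → Emb s r → Emb s (node l r)
    fork : ∀ {s₁ s₂ l r} → Emb s₁ l → Emb s₂ r → Emb (node s₁ s₂) (node l r)

  -- The leaves of t are the copies of the one-leaf tree, i.e. root-to-leaf paths.
  Leaf : Tree → Set
  Leaf = Emb leaf

  infixr 9 _∘E_
  _∘E_ : ∀ {r s t} → Emb s t → Emb r s → Emb r t
  stop       ∘E f          = f
  goL e      ∘E f          = goL (e ∘E f)
  goR e      ∘E f          = goR (e ∘E f)
  fork e₁ e₂ ∘E goL f      = goL (e₁ ∘E f)
  fork e₁ e₂ ∘E goR f      = goR (e₂ ∘E f)
  fork e₁ e₂ ∘E fork f₁ f₂ = fork (e₁ ∘E f₁) (e₂ ∘E f₂)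

  ∘E-assoc : ∀ {q r s t} (e : Emb s t) (f : Emb r s) (g : Emb q r) →
             (e ∘E f) ∘E g ≡ e ∘E (f ∘E g)
  ∘E-assoc stop        f           g           = refl
  ∘E-assoc (goL e)     f           g           = cong goL (∘E-assoc e f g)
  ∘E-assoc (goR e)     f           g           = cong goR (∘E-assoc e f g)
  ∘E-assoc (fork e₁ _) (goL f)     g           = cong goL (∘E-assoc e₁ f g)
  ∘E-assoc (fork _ e₂) (goR f)     g           = cong goR (∘E-assoc e₂ f g)
  ∘E-assoc (fork e₁ _) (fork f₁ _) (goL g)     = cong goL (∘E-assoc e₁ f₁ g)
  ∘E-assoc (fork _ e₂) (fork _ f₂) (goR g)     = cong goR (∘E-assoc e₂ f₂ g)
  ∘E-assoc (fork e₁ e₂) (fork f₁ f₂) (fork g₁ g₂) =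
    cong₂ fork (∘E-assoc e₁ f₁ g₁) (∘E-assoc e₂ f₂ g₂)

  idE : ∀ t → Emb t t
  idE leaf       = stop
  idE (node l r) = fork (idE l) (idE r)

  idE-∘E : ∀ {s t} (f : Emb s t) → idE t ∘E f ≡ f
  idE-∘E stop         = refl
  idE-∘E (goL f)      = cong goL (idE-∘E f)
  idE-∘E (goR f)      = cong goR (idE-∘E f)
  idE-∘E (fork f₁ f₂) = cong₂ fork (idE-∘E f₁) (idE-∘E f₂)

  ∘E-stop : ∀ {t} (x : Leaf t) → x ∘E stop ≡ x
  ∘E-stop stop    = refl
  ∘E-stop (goL x) = cong goL (∘E-stop x)
  ∘E-stop (goR x) = cong goR (∘E-stop x)

  leftmost : ∀ t → Leaf t
  leftmost leaf       = stop
  leftmost (node l r) = goL (leftmost l)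

  data Node : Tree → Set where
    root : ∀ {l r} → Node (node l r)
    nL   : ∀ {l r} → Node l → Node (node l r)
    nR   : ∀ {l r} → Node r → Node (node l r)

  data Sep : ∀ {t} → Node t → Leaf t → Leaf t → Set where
    sroot : ∀ {l r} {x : Leaf l} {y : Leaf r} → Sep {node l r} root (goL x) (goR y)
    sL    : ∀ {l r} {n : Node l} {x y : Leaf l} → Sep n x y → Sep {node l r} (nL n) (goL x) (goL y)
    sR    : ∀ {l r} {n : Node r} {x y : Leaf r} → Sep n x y → Sep {node l r} (nR n) (goR x) (goR y)

  nodeMap : ∀ {s t} → Emb s t → Node s → Node t
  nodeMap (goL e)      n      = nL (nodeMap e n)
  nodeMap (goR e)      n      = nR (nodeMap e n)
  nodeMap (fork e₁ e₂) root   = root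
  nodeMap (fork e₁ e₂) (nL n) = nL (nodeMap e₁ n)
  nodeMap (fork e₁ e₂) (nR n) = nR (nodeMap e₂ n)

  nodeMap-∘E : ∀ {r s t} (e : Emb s t) (f : Emb r s) (n : Node r) →
               nodeMap (e ∘E f) n ≡ nodeMap e (nodeMap f n)
  nodeMap-∘E stop         stop         ()
  nodeMap-∘E (goL e)      f            n      = cong nL (nodeMap-∘E e f n)
  nodeMap-∘E (goR e)      f            n      = cong nR (nodeMap-∘E e f n)
  nodeMap-∘E (fork e₁ _)  (goL f)      n      = cong nL (nodeMap-∘E e₁ f n)
  nodeMap-∘E (fork _ e₂)  (goR f)      n      = cong nR (nodeMap-∘E e₂ f n)
  nodeMap-∘E (fork e₁ e₂) (fork f₁ f₂) root   = refl
  nodeMap-∘E (fork e₁ _)  (fork f₁ _)  (nL n) = cong nL (nodeMap-∘E e₁ f₁ n)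
  nodeMap-∘E (fork _ e₂)  (fork _ f₂)  (nR n) = cong nR (nodeMap-∘E e₂ f₂ n)

  sepMap : ∀ {s t} (e : Emb s t) {n : Node s} {x y : Leaf s} →
           Sep n x y → Sep (nodeMap e n) (e ∘E x) (e ∘E y)
  sepMap (goL e)      s      = sL (sepMap e s)
  sepMap (goR e)      s      = sR (sepMap e s)
  sepMap (fork e₁ e₂) sroot  = sroot
  sepMap (fork e₁ _)  (sL s) = sL (sepMap e₁ s)
  sepMap (fork _ e₂)  (sR s) = sR (sepMap e₂ s)

  data Sign : Set where
    pos neg zer : Sign

  negS : Sign → Sign
  negS pos = neg
  negS neg = pos
  negS zer = zer

  ord : ∀ {t} → Leaf t → Leaf t → Sign
  ord stop    stop    = zer
  ord (goL a) (goL b) = ord a b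
  ord (goR a) (goR b) = ord a b
  ord (goL _) (goR _) = pos
  ord (goR _) (goL _) = neg

  ord-anti : ∀ {t} (a b : Leaf t) → ord b a ≡ negS (ord a b)
  ord-anti stop    stop    = refl
  ord-anti (goL a) (goL b) = ord-anti a b
  ord-anti (goR a) (goR b) = ord-anti a b
  ord-anti (goL a) (goR b) = refl
  ord-anti (goR a) (goL b) = refl

  ord-refl : ∀ {t} (a : Leaf t) → ord a a ≡ zer
  ord-refl stop    = refl
  ord-refl (goL a) = ord-refl a
  ord-refl (goR a) = ord-refl a

  ord-zer : ∀ {t} (a b : Leaf t) → ord a b ≡ zer → a ≡ b
  ord-zer stop    stop    _ = refl
  ord-zer (goL a) (goL b) p = cong goL (ord-zer a b p)
  ord-zer (goR a) (goR b) p = cong goR (ord-zer a b p)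
  ord-zer (goL a) (goR b) ()
  ord-zer (goR a) (goL b) ()

  ≡⇒ord-zer : ∀ {t} {a b : Leaf t} → a ≡ b → ord a b ≡ zer
  ≡⇒ord-zer {a = a} refl = ord-refl a

  ord-sep : ∀ {t} (a b : Leaf t) → ord a b ≡ pos → Σ (Node t) λ n → Sep n a b
  ord-sep stop    stop    ()
  ord-sep (goL a) (goL b) p with ord-sep a b p
  ... | n , s = nL n , sL s
  ord-sep (goR a) (goR b) p with ord-sep a b p
  ... | n , s = nR n , sR s
  ord-sep (goL a) (goR b) p = root , sroot
  ord-sep (goR a) (goL b) ()

  ord-emb : ∀ {s t} (e : Emb s t) (a b : Leaf s) → ord (e ∘E a) (e ∘E b) ≡ ord a b
  ord-emb stop         a       b       = refl
  ord-emb (goL e)      a       b       = ord-emb e a b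
  ord-emb (goR e)      a       b       = ord-emb e a b
  ord-emb (fork e₁ e₂) (goL a) (goL b) = ord-emb e₁ a b
  ord-emb (fork e₁ e₂) (goR a) (goR b) = ord-emb e₂ a b
  ord-emb (fork e₁ e₂) (goL a) (goR b) = refl
  ord-emb (fork e₁ e₂) (goR a) (goL b) = refl

  ∘E-injective : ∀ {s t} (e : Emb s t) {a b : Leaf s} → e ∘E a ≡ e ∘E b → a ≡ b
  ∘E-injective e {a} {b} eq = ord-zer a b (trans (sym (ord-emb e a b)) (≡⇒ord-zer eq))

  -- For a triple spread
  -- over both subtrees of the root it is the orientation of a point set whose
  -- left part lies deep below its right part: the orientation is then decided
  -- by the left-to-right order of the two leaves on the same side.
  σ : ∀ {t} → Leaf t → Leaf t → Leaf t → Sign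
  σ stop    stop    stop    = zer
  σ (goL a) (goL b) (goL c) = σ a b c
  σ (goR a) (goR b) (goR c) = σ a b c
  σ (goL a) (goL b) (goR c) = ord a b
  σ (goL a) (goR c) (goL b) = ord b a
  σ (goR c) (goL a) (goL b) = ord a b
  σ (goL a) (goR b) (goR c) = ord c b
  σ (goR b) (goL a) (goR c) = ord b c
  σ (goR b) (goR c) (goL a) = ord c b

  σ-rot : ∀ {t} (x y z : Leaf t) → σ y z x ≡ σ x y z
  σ-rot stop    stop    stop    = refl
  σ-rot (goL a) (goL b) (goL c) = σ-rot a b c
  σ-rot (goR a) (goR b) (goR c) = σ-rot a b c
  σ-rot (goL a) (goL b) (goR c) = refl
  σ-rot (goL a) (goR c) (goL b) = refl
  σ-rot (goR c) (goL a) (goL b) = refl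
  σ-rot (goL a) (goR b) (goR c) = refl
  σ-rot (goR b) (goL a) (goR c) = refl
  σ-rot (goR b) (goR c) (goL a) = refl

  σ-emb : ∀ {s t} (e : Emb s t) (x y z : Leaf s) → σ (e ∘E x) (e ∘E y) (e ∘E z) ≡ σ x y z
  σ-emb stop         x       y       z       = refl
  σ-emb (goL e)      x       y       z       = σ-emb e x y z
  σ-emb (goR e)      x       y       z       = σ-emb e x y z
  σ-emb (fork e₁ e₂) (goL a) (goL b) (goL c) = σ-emb e₁ a b c
  σ-emb (fork e₁ e₂) (goR a) (goR b) (goR c) = σ-emb e₂ a b c
  σ-emb (fork e₁ e₂) (goL a) (goL b) (goR c) = ord-emb e₁ a b
  σ-emb (fork e₁ e₂) (goL a) (goR c) (goL b) = ord-emb e₁ b a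
  σ-emb (fork e₁ e₂) (goR c) (goL a) (goL b) = ord-emb e₁ a b
  σ-emb (fork e₁ e₂) (goL a) (goR b) (goR c) = ord-emb e₂ c b
  σ-emb (fork e₁ e₂) (goR b) (goL a) (goR c) = ord-emb e₂ b c
  σ-emb (fork e₁ e₂) (goR b) (goR c) (goL a) = ord-emb e₂ c b

  σ-zer : ∀ {t} (x y z : Leaf t) → σ x y z ≡ zer → x ≡ y ⊎ (y ≡ z ⊎ x ≡ z)
  σ-zer stop    stop    stop    _ = inj₁ refl
  σ-zer (goL a) (goL b) (goL c) p with σ-zer a b c p
  ... | inj₁ q        = inj₁ (cong goL q)
  ... | inj₂ (inj₁ q) = inj₂ (inj₁ (cong goL q))
  ... | inj₂ (inj₂ q) = inj₂ (inj₂ (cong goL q))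
  σ-zer (goR a) (goR b) (goR c) p with σ-zer a b c p
  ... | inj₁ q        = inj₁ (cong goR q)
  ... | inj₂ (inj₁ q) = inj₂ (inj₁ (cong goR q))
  ... | inj₂ (inj₂ q) = inj₂ (inj₂ (cong goR q))
  σ-zer (goL a) (goL b) (goR c) p = inj₁ (cong goL (ord-zer a b p))
  σ-zer (goL a) (goR c) (goL b) p = inj₂ (inj₂ (cong goL (sym (ord-zer b a p))))
  σ-zer (goR c) (goL a) (goL b) p = inj₂ (inj₁ (cong goL (ord-zer a b p)))
  σ-zer (goL a) (goR b) (goR c) p = inj₂ (inj₁ (cong goR (sym (ord-zer c b p))))
  σ-zer (goR b) (goL a) (goR c) p = inj₂ (inj₂ (cong goR (ord-zer b c p)))
  σ-zer (goR b) (goR c) (goL a) p = inj₁ (cong goR (sym (ord-zer c b p)))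


module TreeRamsey where

  open Trees
  open import Data.Nat using (ℕ; zero; suc; _+_; _≤_; _⊔_; s≤s)
  open import Data.Nat.Properties using (+-suc; suc-injective; ≤-refl; ≤-trans; m≤m⊔n; m≤n⊔m)
  open import Data.Fin using (Fin; zero; suc)
  open import Data.Product using (Σ; _,_; proj₁; proj₂)
  open import Data.Sum using (_⊎_; inj₁; inj₂)
  open import Function using (case_of_)
  open import Relation.Binary.PropositionalEquality using (_≡_; refl; sym; trans; cong; cong₂; subst)

  zeroLeafOrNone : ∀ {k} t (d : Leaf t → Fin (suc k)) →
    (Σ (Leaf t) λ x → d x ≡ zero) ⊎ (∀ x → Σ (Fin k) λ j → d x ≡ suc j)
  zeroLeafOrNone leaf d with d stop in eq
  ... | zero  = inj₁ (stop , eq)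
  ... | suc j = inj₂ λ { stop → j , eq }
  zeroLeafOrNone (node l r) d with zeroLeafOrNone l (λ x → d (goL x)) | zeroLeafOrNone r (λ x → d (goR x))
  ... | inj₁ (x , p) | _            = inj₁ (goL x , p)
  ... | inj₂ _       | inj₁ (x , p) = inj₁ (goR x , p)
  ... | inj₂ h₁      | inj₂ h₂      = inj₂ λ { (goL x) → h₁ x ; (goR x) → h₂ x }

  ZeroOrAvoid : ℕ → Tree → Tree → Tree → Set
  ZeroOrAvoid k s t W = ∀ (d : Leaf W → Fin (suc k)) →
    (Σ (Emb s W) λ e → ∀ x → d (e ∘E x) ≡ zero) ⊎
    (Σ (Emb t W) λ e → ∀ x → Σ (Fin k) λ j → d (e ∘E x) ≡ suc j)

  -- Take W = s with every leaf replaced by t: either each copy of t contains a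
  -- 0-leaf, and these leaves form a 0-coloured copy of s, or some copy avoids 0.
  zeroOrAvoid : ∀ k s t → Σ Tree (ZeroOrAvoid k s t)
  zeroOrAvoid k leaf t = t , decide
    where
    decide : ZeroOrAvoid k leaf t t
    decide d with zeroLeafOrNone t d
    ... | inj₁ (x , p) = inj₁ (x , λ { stop → trans (cong d (∘E-stop x)) p })
    ... | inj₂ h       = inj₂ (idE t , λ x → subst (λ z → Σ _ λ j → d z ≡ suc j) (sym (idE-∘E x)) (h x))
  zeroOrAvoid k (node s₁ s₂) t = node (proj₁ W₁) (proj₁ W₂) , decide
    where
    W₁ : Σ Tree (ZeroOrAvoid k s₁ t)
    W₁ = zeroOrAvoid k s₁ t
    W₂ : Σ Tree (ZeroOrAvoid k s₂ t)
    W₂ = zeroOrAvoid k s₂ t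
    decide : ZeroOrAvoid k (node s₁ s₂) t (node (proj₁ W₁) (proj₁ W₂))
    decide d with proj₂ W₁ (λ x → d (goL x)) | proj₂ W₂ (λ x → d (goR x))
    ... | inj₁ (e₁ , h₁) | inj₁ (e₂ , h₂) = inj₁ (fork e₁ e₂ , λ { (goL x) → h₁ x ; (goR x) → h₂ x })
    ... | inj₂ (e , h)   | _              = inj₂ (goL e , h)
    ... | inj₁ _         | inj₂ (e , h)   = inj₂ (goR e , h)

  LeafRamsey : ℕ → Tree → Tree → Set
  LeafRamsey k s V = ∀ (d : Leaf V → Fin k) →
    Σ (Fin k) λ a → Σ (Emb s V) λ e → ∀ x → d (e ∘E x) ≡ a

  -- Induction on k: a copy coloured 0, or a copy of the tree for k colours
  -- that avoids 0.
  leafRamsey : ∀ k s → Σ Tree (LeafRamsey k s)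
  leafRamsey zero    s = s , λ d → case d (leftmost s) of λ ()
  leafRamsey (suc k) s = proj₁ W , monochromatic
    where
    V : Σ Tree (LeafRamsey k s)
    V = leafRamsey k s
    W : Σ Tree (ZeroOrAvoid k s (proj₁ V))
    W = zeroOrAvoid k s (proj₁ V)
    monochromatic : LeafRamsey (suc k) s (proj₁ W)
    monochromatic d with proj₂ W d
    ... | inj₁ (e , h) = zero , e , h
    ... | inj₂ (e , h) with proj₂ V (λ x → proj₁ (h x))
    ...   | a , e' , h' = suc a , e ∘E e' , λ x →
      trans (cong d (∘E-assoc e e' x)) (trans (proj₂ (h (e' ∘E x))) (cong suc (h' x)))

  FamilyRamsey : ℕ → Tree → Tree → Tree → Set
  FamilyRamsey k s B V = ∀ (d : Leaf B → Leaf V → Fin k) →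
    Σ (Emb s V) λ e → ∀ y x x' → d y (e ∘E x) ≡ d y (e ∘E x')

  familyRamsey : ∀ k s B → Σ Tree (FamilyRamsey k s B)
  familyRamsey k s leaf = proj₁ (leafRamsey k s) , constant
    where
    constant : FamilyRamsey k s leaf (proj₁ (leafRamsey k s))
    constant d with proj₂ (leafRamsey k s) (d stop)
    ... | a , e , h = e , λ { stop x x' → trans (h x) (sym (h x')) }
  familyRamsey k s (node B₁ B₂) = proj₁ V , constant
    where
    V₂ : Σ Tree (FamilyRamsey k s B₂)
    V₂ = familyRamsey k s B₂
    V : Σ Tree (FamilyRamsey k (proj₁ V₂) B₁)
    V = familyRamsey k (proj₁ V₂) B₁
    constant : FamilyRamsey k s (node B₁ B₂) (proj₁ V)
    constant d with proj₂ V (λ y x → d (goL y) x)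
    ... | e₁ , h₁ with proj₂ V₂ (λ y x → d (goR y) (e₁ ∘E x))
    ...   | e₂ , h₂ = e₁ ∘E e₂ , λ where
        (goL y) x x' → trans (cong (d (goL y)) (∘E-assoc e₁ e₂ x))
                         (trans (h₁ y (e₂ ∘E x) (e₂ ∘E x')) (sym (cong (d (goL y)) (∘E-assoc e₁ e₂ x'))))
        (goR y) x x' → trans (cong (d (goR y)) (∘E-assoc e₁ e₂ x))
                         (trans (h₂ y x x') (sym (cong (d (goR y)) (∘E-assoc e₁ e₂ x'))))

  -- k-colourings of the pairs of leaves of t (only pairs in left-to-right
  -- order are ever consulted).
  Colouring : ℕ → Tree → Set
  Colouring k t = Leaf t → Leaf t → Fin k

  Canonical : ∀ {k s t} → (Node s → Fin k) → Emb s t → Colouring k t → Set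
  Canonical {s = s} κ e c = ∀ {n : Node s} {x y : Leaf s} → Sep n x y → c (e ∘E x) (e ∘E y) ≡ κ n

  CanonRamsey : ℕ → Tree → Tree → Set
  CanonRamsey k s U = ∀ (c : Colouring k U) →
    Σ (Node s → Fin k) λ κ → Σ (Emb s U) λ e → Canonical κ e c

  -- With U = node A B, first
  -- make the colour of a pair (left leaf, right leaf) independent of the left
  -- leaf (familyRamsey), then independent of the right leaf (leafRamsey), and
  -- canonise inside each side.
  canonRamsey : ∀ k s → Σ Tree (CanonRamsey k s)
  canonRamsey k leaf = leaf , λ c → (λ ()) , stop , λ ()
  canonRamsey k (node s₁ s₂) = node A B , canonical
    where
    C₁ : Σ Tree (CanonRamsey k s₁)
    C₁ = canonRamsey k s₁
    C₂ : Σ Tree (CanonRamsey k s₂)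
    C₂ = canonRamsey k s₂
    U₁ U₂ A B : Tree
    U₁ = proj₁ C₁
    U₂ = proj₁ C₂
    B  = proj₁ (leafRamsey k U₂)
    A  = proj₁ (familyRamsey k U₁ B)
    canonical : CanonRamsey k (node s₁ s₂) (node A B)
    canonical c with proj₂ (familyRamsey k U₁ B) (λ y x → c (goL x) (goR y))
    ... | eA , hA with proj₂ (leafRamsey k U₂) (λ y → c (goL (eA ∘E leftmost U₁)) (goR y))
    ... | a , eB , hB with proj₂ C₁ (λ x x' → c (goL (eA ∘E x)) (goL (eA ∘E x')))
                         | proj₂ C₂ (λ y y' → c (goR (eB ∘E y)) (goR (eB ∘E y')))
    ... | κ₁ , e₁ , h₁ | κ₂ , e₂ , h₂ = κ , fork (eA ∘E e₁) (eB ∘E e₂) , canon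
      where
      κ : Node (node s₁ s₂) → Fin k
      κ root   = a
      κ (nL n) = κ₁ n
      κ (nR n) = κ₂ n
      canon : Canonical κ (fork (eA ∘E e₁) (eB ∘E e₂)) c
      canon (sroot {x = x} {y = y}) rewrite ∘E-assoc eA e₁ x | ∘E-assoc eB e₂ y =
        trans (hA (eB ∘E (e₂ ∘E y)) (e₁ ∘E x) (leftmost U₁)) (hB (e₂ ∘E y))
      canon (sL {x = x} {y = y} s) rewrite ∘E-assoc eA e₁ x | ∘E-assoc eA e₁ y = h₁ s
      canon (sR {x = x} {y = y} s) rewrite ∘E-assoc eB e₂ x | ∘E-assoc eB e₂ y = h₂ s

  complete : ℕ → Tree
  complete zero    = leaf
  complete (suc h) = node (complete h) (complete h)

  ZeroOrAvoidNodes : ℕ → ℕ → ℕ → ℕ → Set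
  ZeroOrAvoidNodes k h a b = ∀ (κ : Node (complete h) → Fin (suc k)) →
    (Σ (Emb (complete a) (complete h)) λ f → ∀ n → κ (nodeMap f n) ≡ zero) ⊎
    (Σ (Emb (complete b) (complete h)) λ f → ∀ n → Σ (Fin k) λ j → κ (nodeMap f n) ≡ suc j)

  zeroOrAvoidNodes : ∀ k h a b → a + b ≡ h → ZeroOrAvoidNodes k h a b
  zeroOrAvoidNodes k h       zero    b       eq κ = inj₁ (leftmost (complete h) , λ ())
  zeroOrAvoidNodes k h       (suc a) zero    eq κ = inj₂ (leftmost (complete h) , λ ())
  zeroOrAvoidNodes k zero    (suc a) (suc b) () κ
  zeroOrAvoidNodes k (suc h) (suc a) (suc b) eq κ with κ root in κroot
  ... | zero with zeroOrAvoidNodes k h a (suc b) h≡ (λ n → κ (nL n))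
                | zeroOrAvoidNodes k h a (suc b) h≡ (λ n → κ (nR n))
    where
    h≡ : a + suc b ≡ h
    h≡ = suc-injective eq
  ...   | inj₁ (f₁ , h₁) | inj₁ (f₂ , h₂) =
            inj₁ (fork f₁ f₂ , λ { root → κroot ; (nL n) → h₁ n ; (nR n) → h₂ n })
  ...   | inj₂ (f , hf)  | _              = inj₂ (goL f , hf)
  ...   | inj₁ _         | inj₂ (f , hf)  = inj₂ (goR f , hf)
  zeroOrAvoidNodes k (suc h) (suc a) (suc b) eq κ | suc j
    with zeroOrAvoidNodes k h (suc a) b h≡ (λ n → κ (nL n))
       | zeroOrAvoidNodes k h (suc a) b h≡ (λ n → κ (nR n))
    where
    h≡ : suc a + b ≡ h
    h≡ = trans (sym (+-suc a b)) (suc-injective eq)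
  ... | inj₂ (f₁ , h₁) | inj₂ (f₂ , h₂) =
            inj₂ (fork f₁ f₂ , λ { root → j , κroot ; (nL n) → h₁ n ; (nR n) → h₂ n })
  ... | inj₁ (f , hf)  | _              = inj₁ (goL f , hf)
  ... | inj₂ _         | inj₁ (f , hf)  = inj₁ (goR f , hf)

  NodeRamsey : ℕ → ℕ → ℕ → Set
  NodeRamsey k m h = ∀ (κ : Node (complete h) → Fin k) →
    Σ (Fin k) λ a → Σ (Emb (complete m) (complete h)) λ f → ∀ n → κ (nodeMap f n) ≡ a

  nodeRamsey : ∀ k m → Σ ℕ (NodeRamsey k m)
  nodeRamsey zero    m = 1 , λ κ → case κ root of λ ()
  nodeRamsey (suc k) m = m + proj₁ H , monochromatic
    where
    H : Σ ℕ (NodeRamsey k m)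
    H = nodeRamsey k m
    monochromatic : NodeRamsey (suc k) m (m + proj₁ H)
    monochromatic κ with zeroOrAvoidNodes k (m + proj₁ H) m (proj₁ H) refl κ
    ... | inj₁ (f , hf) = zero , f , hf
    ... | inj₂ (f , hf) with proj₂ H (λ n → proj₁ (hf n))
    ...   | a , f' , hf' = suc a , f ∘E f' , λ n →
      trans (cong κ (nodeMap-∘E f f' n)) (trans (proj₂ (hf (nodeMap f' n))) (cong suc (hf' n)))

  depth : Tree → ℕ
  depth leaf       = zero
  depth (node l r) = suc (depth l ⊔ depth r)

  intoComplete : ∀ s d → depth s ≤ d → Emb s (complete d)
  intoComplete leaf       d       _       = leftmost (complete d)
  intoComplete (node l r) (suc d) (s≤s p) =
    fork (intoComplete l d (≤-trans (m≤m⊔n (depth l) (depth r)) p))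
         (intoComplete r d (≤-trans (m≤n⊔m (depth l) (depth r)) p))

  PairRamsey : ℕ → Tree → Tree → Set
  PairRamsey k s U = ∀ (c : Colouring k U) → Σ (Fin k) λ a → Σ (Emb s U) λ F →
    ∀ {n : Node s} {x y : Leaf s} → Sep n x y → c (F ∘E x) (F ∘E y) ≡ a

  -- Canonise a complete tree that is Ramsey for nodes; the monochromatic
  -- complete subtree contains a copy of s, on which all pairs share a colour.
  pairRamsey : ∀ k s → Σ Tree (PairRamsey k s)
  pairRamsey k s = proj₁ C , monochromatic
    where
    N : Σ ℕ (NodeRamsey k (depth s))
    N = nodeRamsey k (depth s)
    C : Σ Tree (CanonRamsey k (complete (proj₁ N)))
    C = canonRamsey k (complete (proj₁ N))
    fit : Emb s (complete (depth s))
    fit = intoComplete s (depth s) ≤-refl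
    monochromatic : PairRamsey k s (proj₁ C)
    monochromatic c with proj₂ C c
    ... | κ , e , he with proj₂ N κ
    ...   | a , f , hf = a , e ∘E (f ∘E fit) , λ {n} {x} {y} sp →
      trans (cong₂ c (∘E-assoc e (f ∘E fit) x) (∘E-assoc e (f ∘E fit) y))
        (trans (he (sepMap (f ∘E fit) sp))
          (trans (cong κ (nodeMap-∘E f fit n)) (hf (nodeMap fit n))))


module Orientation where

  open Trees using (Sign; pos; neg; zer; negS)
  open import Data.Rational using (ℚ; _*_; -_; 0ℚ; _<_)
  import Data.Rational.Base as ℚ
  import Data.Rational.Properties as ℚP
  open import Data.Product using (_×_; _,_)
  open import Data.Empty using (⊥-elim)
  open import Function.Bundles using (_⇔_; mk⇔)
  open import Relation.Binary.PropositionalEquality using (_≡_; refl; sym; cong; subst)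
  open import Data.Rational.Solver
  open +-*-Solver

  Sgn : Sign → ℚ → Set
  Sgn pos v = 0ℚ < v
  Sgn neg v = v < 0ℚ
  Sgn zer v = v ≡ 0ℚ

  Sgn-neg : ∀ s v → Sgn s v → Sgn (negS s) (- v)
  Sgn-neg pos v p = ℚP.neg-antimono-< p
  Sgn-neg neg v p = ℚP.neg-antimono-< p
  Sgn-neg zer v p = cong -_ p

  Sgn-zero : ∀ s → Sgn s 0ℚ → s ≡ zer
  Sgn-zero pos p = ⊥-elim (ℚP.<-irrefl refl p)
  Sgn-zero neg p = ⊥-elim (ℚP.<-irrefl refl p)
  Sgn-zero zer p = refl

  0<* : ∀ {a b} → 0ℚ < a → 0ℚ < b → 0ℚ < a * b
  0<* {a} {b} p q = ℚP.positive⁻¹ (a * b) {{ℚP.pos*pos⇒pos a {{ℚ.positive p}} b {{ℚ.positive q}}}}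

  Sgn-scale : ∀ {c} s v → 0ℚ < c → Sgn s v → Sgn s (c * v)
  Sgn-scale pos v hc h = 0<* hc h
  Sgn-scale {c} neg v hc h =
    subst (_< 0ℚ) (solve 2 (λ c v → :- (c :* (:- v)) := c :* v) refl c v)
      (ℚP.neg-antimono-< (0<* hc (ℚP.neg-antimono-< h)))
  Sgn-scale {c} zer v hc h = subst (λ w → c * w ≡ 0ℚ) (sym h) (ℚP.*-zeroʳ c)

  same-sign-⇔ : ∀ s {v w} → Sgn s v → Sgn s w → ((0ℚ < v) ⇔ (0ℚ < w)) × ((v < 0ℚ) ⇔ (w < 0ℚ))
  same-sign-⇔ pos hv hw = mk⇔ (λ _ → hw) (λ _ → hv) ,
                          mk⇔ (λ h → ⊥-elim (ℚP.<-asym hv h)) (λ h → ⊥-elim (ℚP.<-asym hw h))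
  same-sign-⇔ neg hv hw = mk⇔ (λ h → ⊥-elim (ℚP.<-asym hv h)) (λ h → ⊥-elim (ℚP.<-asym hw h)) ,
                          mk⇔ (λ _ → hw) (λ _ → hv)
  same-sign-⇔ zer hv hw =
    mk⇔ (λ h → ⊥-elim (ℚP.<-irrefl (sym hv) h)) (λ h → ⊥-elim (ℚP.<-irrefl (sym hw) h)) ,
    mk⇔ (λ h → ⊥-elim (ℚP.<-irrefl hv h)) (λ h → ⊥-elim (ℚP.<-irrefl hw h))

  orient-rot : ∀ p q r → orient q r p ≡ orient p q r
  orient-rot (x₁ , y₁) (x₂ , y₂) (x₃ , y₃) = solve 6 (λ x₁ y₁ x₂ y₂ x₃ y₃ →
    ((x₃ :- x₂) :* (y₁ :- y₂)) :- ((y₃ :- y₂) :* (x₁ :- x₂)) :=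
    ((x₂ :- x₁) :* (y₃ :- y₁)) :- ((y₂ :- y₁) :* (x₃ :- x₁))) refl x₁ y₁ x₂ y₂ x₃ y₃

  orient-swap : ∀ p q r → orient q p r ≡ - orient p q r
  orient-swap (x₁ , y₁) (x₂ , y₂) (x₃ , y₃) = solve 6 (λ x₁ y₁ x₂ y₂ x₃ y₃ →
    ((x₁ :- x₂) :* (y₃ :- y₂)) :- ((y₁ :- y₂) :* (x₃ :- x₂)) :=
    :- (((x₂ :- x₁) :* (y₃ :- y₁)) :- ((y₂ :- y₁) :* (x₃ :- x₁)))) refl x₁ y₁ x₂ y₂ x₃ y₃

  orient-same : ∀ p r → orient p p r ≡ 0ℚ
  orient-same (x₁ , y₁) (x₃ , y₃) = solve 4 (λ x₁ y₁ x₃ y₃ →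
    ((x₁ :- x₁) :* (y₃ :- y₁)) :- ((y₁ :- y₁) :* (x₃ :- x₁)) := con 0ℚ) refl x₁ y₁ x₃ y₃


module Realisation where

  open Trees
  open Orientation
  open import Data.Rational using (ℚ; _*_; 0ℚ; _<_)
  open import Data.Sum using (_⊎_; inj₁; inj₂; [_,_]′)
  open import Data.Product using (_×_; _,_)
  open import Function using (_∘_)
  open import Relation.Binary.PropositionalEquality using (_≡_; refl; sym; trans; cong; subst; subst₂)

  Agrees : ∀ {t} → Leaf t → Leaf t → Leaf t → Point → Point → Point → Set
  Agrees x y z p q r = Sgn (σ x y z) (orient p q r)

  agrees-rotate : ∀ {t} (x y z : Leaf t) p q r → Agrees x y z p q r → Agrees y z x q r p
  agrees-rotate x y z p q r =
    subst₂ Sgn (sym (σ-rot x y z)) (sym (orient-rot p q r))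

  record Realises {I : Set} {t : Tree} (leafOf : I → Leaf t) (pointOf : I → Point) : Set where
    field
      agrees   : ∀ i j m → Agrees (leafOf i) (leafOf j) (leafOf m) (pointOf i) (pointOf j) (pointOf m)
      faithful : ∀ i j → ord (leafOf i) (leafOf j) ≡ zer → pointOf i ≡ pointOf j

  open Realises public

  realises-point : ∀ {I} (λ₀ : I → Leaf leaf) (π : I → Point) → (∀ i j → π i ≡ π j) → Realises λ₀ π
  realises-point λ₀ π same = record
    { agrees   = λ i j m → subst (λ s → Sgn s (orient (π i) (π j) (π m))) (sym (σ-leaf (λ₀ i) (λ₀ j) (λ₀ m)))
                             (subst (λ p → orient (π i) p (π m) ≡ 0ℚ) (same i j) (orient-same (π i) (π m)))
    ; faithful = λ i j _ → same i j }
    where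
    σ-leaf : (x y z : Leaf leaf) → σ x y z ≡ zer
    σ-leaf stop stop stop = refl

  realises-reindex : ∀ {I J t} {λ₁ : I → Leaf t} {π₁ : I → Point} {λ₂ : J → Leaf t} {π₂ : J → Point}
    (h : J → I) → (∀ j → λ₂ j ≡ λ₁ (h j)) → (∀ j → π₂ j ≡ π₁ (h j)) →
    Realises λ₁ π₁ → Realises λ₂ π₂
  realises-reindex {λ₁ = λ₁} {π₁} {λ₂} {π₂} h eλ eπ R = record
    { agrees   = λ i j m → transport (eλ i) (eλ j) (eλ m) (eπ i) (eπ j) (eπ m) (agrees R (h i) (h j) (h m))
    ; faithful = λ i j e → trans (eπ i) (trans (faithful R (h i) (h j)
                             (subst₂ (λ x y → ord x y ≡ zer) (eλ i) (eλ j) e)) (sym (eπ j))) }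
    where
    transport : ∀ {t} {x x' y y' z z' : Leaf t} {p p' q q' r r'} →
      x ≡ x' → y ≡ y' → z ≡ z' → p ≡ p' → q ≡ q' → r ≡ r' → Agrees x' y' z' p' q' r' → Agrees x y z p q r
    transport refl refl refl refl refl refl a = a

  realises-scale : ∀ {I t} {λ₀ : I → Leaf t} {π : I → Point} (φ : Point → Point) {c : ℚ} → 0ℚ < c →
    (∀ p q r → orient (φ p) (φ q) (φ r) ≡ c * orient p q r) →
    Realises λ₀ π → Realises λ₀ (φ ∘ π)
  realises-scale {π = π} φ c>0 scale R = record
    { agrees   = λ i j m → subst (Sgn _) (sym (scale (π i) (π j) (π m))) (Sgn-scale _ _ c>0 (agrees R i j m))
    ; faithful = λ i j e → cong φ (faithful R i j e) }

  glueLeaf : ∀ {I₁ I₂ : Set} {t₁ t₂} → (I₁ → Leaf t₁) → (I₂ → Leaf t₂) → I₁ ⊎ I₂ → Leaf (node t₁ t₂)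
  glueLeaf λ₁ λ₂ = [ goL ∘ λ₁ , goR ∘ λ₂ ]′

  gluePoint : ∀ {I₁ I₂ : Set} → (I₁ → Point) → (I₂ → Point) → I₁ ⊎ I₂ → Point
  gluePoint π₁ π₂ = [ π₁ , π₂ ]′

  -- The leaf-ordered analogue of "π₁ lies deep below π₂": every point of the
  -- second family lies above every line through two points of the first, and
  -- every point of the first lies below every line through two of the second.
  LiesBelow : ∀ {I₁ I₂ : Set} {t₁ t₂} → (I₁ → Leaf t₁) → (I₁ → Point) → (I₂ → Leaf t₂) → (I₂ → Point) → Set
  LiesBelow λ₁ π₁ λ₂ π₂ =
    (∀ i i' j → ord (λ₁ i) (λ₁ i') ≡ pos → CCW (π₁ i) (π₁ i') (π₂ j)) ×
    (∀ j j' i → ord (λ₂ j) (λ₂ j') ≡ pos → CW (π₂ j) (π₂ j') (π₁ i))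

  -- A triple spread over both families is a rotation of one whose
  -- two same-side points come first, and the orientation of that one is
  -- given by LiesBelow (or is zero if the two points coincide).
  realises-glue : ∀ {I₁ I₂ : Set} {t₁ t₂} {λ₁ : I₁ → Leaf t₁} {π₁ : I₁ → Point} {λ₂ : I₂ → Leaf t₂} {π₂ : I₂ → Point} →
    Realises λ₁ π₁ → Realises λ₂ π₂ → LiesBelow λ₁ π₁ λ₂ π₂ →
    Realises (glueLeaf λ₁ λ₂) (gluePoint π₁ π₂)
  realises-glue {λ₁ = λ₁} {π₁} {λ₂} {π₂} R₁ R₂ (above , below) = record { agrees = agree ; faithful = faith }
    where
    lowerPair : ∀ i i' j → Agrees (goL (λ₁ i)) (goL (λ₁ i')) (goR (λ₂ j)) (π₁ i) (π₁ i') (π₂ j)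
    lowerPair i i' j = bySign (ord (λ₁ i) (λ₁ i')) refl
      where
      bySign : ∀ s → ord (λ₁ i) (λ₁ i') ≡ s → Sgn s (orient (π₁ i) (π₁ i') (π₂ j))
      bySign pos e = above i i' j e
      bySign neg e = subst (Sgn neg) (sym (orient-swap (π₁ i') (π₁ i) (π₂ j)))
        (Sgn-neg pos _ (above i' i j (trans (ord-anti (λ₁ i) (λ₁ i')) (cong negS e))))
      bySign zer e = subst (λ p → orient (π₁ i) p (π₂ j) ≡ 0ℚ) (faithful R₁ i i' e) (orient-same (π₁ i) (π₂ j))

    upperPair : ∀ j j' i → Agrees (goR (λ₂ j)) (goR (λ₂ j')) (goL (λ₁ i)) (π₂ j) (π₂ j') (π₁ i)
    upperPair j j' i = bySign (ord (λ₂ j') (λ₂ j)) refl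
      where
      bySign : ∀ s → ord (λ₂ j') (λ₂ j) ≡ s → Sgn s (orient (π₂ j) (π₂ j') (π₁ i))
      bySign pos e = subst (Sgn pos) (sym (orient-swap (π₂ j') (π₂ j) (π₁ i)))
        (Sgn-neg neg _ (below j' j i e))
      bySign neg e = below j j' i (trans (ord-anti (λ₂ j') (λ₂ j)) (cong negS e))
      bySign zer e = subst (λ p → orient (π₂ j) p (π₁ i) ≡ 0ℚ) (sym (faithful R₂ j' j e)) (orient-same (π₂ j) (π₁ i))

    GluedAgrees : (u v w : _ ⊎ _) → Set
    GluedAgrees u v w = Agrees (glueLeaf λ₁ λ₂ u) (glueLeaf λ₁ λ₂ v) (glueLeaf λ₁ λ₂ w)
                           (gluePoint π₁ π₂ u) (gluePoint π₁ π₂ v) (gluePoint π₁ π₂ w)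

    rotate : ∀ u v w → GluedAgrees u v w → GluedAgrees v w u
    rotate u v w = agrees-rotate (glueLeaf λ₁ λ₂ u) (glueLeaf λ₁ λ₂ v) (glueLeaf λ₁ λ₂ w)
                                 (gluePoint π₁ π₂ u) (gluePoint π₁ π₂ v) (gluePoint π₁ π₂ w)

    agree : ∀ u v w → GluedAgrees u v w
    agree (inj₁ i) (inj₁ i') (inj₁ i'') = agrees R₁ i i' i''
    agree (inj₂ j) (inj₂ j') (inj₂ j'') = agrees R₂ j j' j''
    agree (inj₁ i) (inj₁ i') (inj₂ j)   = lowerPair i i' j
    agree (inj₁ i) (inj₂ j)  (inj₁ i')  = rotate (inj₁ i') (inj₁ i) (inj₂ j) (lowerPair i' i j)
    agree (inj₂ j) (inj₁ i)  (inj₁ i')  =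
      rotate (inj₁ i') (inj₂ j) (inj₁ i) (rotate (inj₁ i) (inj₁ i') (inj₂ j) (lowerPair i i' j))
    agree (inj₂ j) (inj₂ j') (inj₁ i)   = upperPair j j' i
    agree (inj₁ i) (inj₂ j)  (inj₂ j')  =
      rotate (inj₂ j') (inj₁ i) (inj₂ j) (rotate (inj₂ j) (inj₂ j') (inj₁ i) (upperPair j j' i))
    agree (inj₂ j) (inj₁ i)  (inj₂ j')  = rotate (inj₂ j') (inj₂ j) (inj₁ i) (upperPair j' j i)

    faith : ∀ u v → ord (glueLeaf λ₁ λ₂ u) (glueLeaf λ₁ λ₂ v) ≡ zer → gluePoint π₁ π₂ u ≡ gluePoint π₁ π₂ v
    faith (inj₁ i) (inj₁ i') e = faithful R₁ i i' e
    faith (inj₂ j) (inj₂ j') e = faithful R₂ j j' e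
    faith (inj₁ _) (inj₂ _)  ()
    faith (inj₂ _) (inj₁ _)  ()


-- The two shrinking maps used to draw a tree, and the invariants they keep:
-- every picture lies in the unit square and the segment between two leaves
-- (in left-to-right order) rises to the right with slope in [-1, 1].
module Shrinking where

  open Orientation using (0<*)
  open import Data.Rational using (ℚ; _*_; _-_; _+_; 0ℚ; 1ℚ; _/_; _<_; _≤_)
  import Data.Rational.Base as ℚ
  import Data.Rational.Properties as ℚP
  open import Data.Integer using (+_)
  open import Data.Empty using (⊥)
  open import Data.Product using (_×_; _,_; proj₁)
  open import Relation.Binary.PropositionalEquality using (_≡_; refl; sym; trans; cong; subst)
  open import Relation.Nullary.Decidable using (True; toWitness)
  open import Data.Rational.Solver
  open +-*-Solver

  positive! : (q : ℚ) → {True (0ℚ ℚP.<? q)} → 0ℚ < q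
  positive! q {w} = toWitness w

  nonneg! : (q : ℚ) → {True (0ℚ ℚP.≤? q)} → 0ℚ ≤ q
  nonneg! q {w} = toWitness w

  0≤+ : ∀ {a b} → 0ℚ ≤ a → 0ℚ ≤ b → 0ℚ ≤ a + b
  0≤+ = ℚP.+-mono-≤

  0<+ : ∀ {a b} → 0ℚ < a → 0ℚ ≤ b → 0ℚ < a + b
  0<+ = ℚP.+-mono-<-≤

  0≤* : ∀ {a b} → 0ℚ ≤ a → 0ℚ ≤ b → 0ℚ ≤ a * b
  0≤* {a} {b} p q = ℚP.nonNegative⁻¹ (a * b) {{ℚP.nonNeg*nonNeg⇒nonNeg a {{ℚ.nonNegative p}} b {{ℚ.nonNegative q}}}}

  ≤-by : ∀ {a b} → b ≡ a → 0ℚ ≤ a → 0ℚ ≤ b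
  ≤-by e = subst (0ℚ ≤_) (sym e)

  <-by : ∀ {a b} → b ≡ a → 0ℚ < a → 0ℚ < b
  <-by e = subst (0ℚ <_) (sym e)

  ¼ ¾ ½ squash : ℚ
  ¼ = + 1 / 4
  ¾ = + 3 / 4
  ½ = + 1 / 2
  squash = + 1 / 40

  -- Shrink horizontally by 4 and vertically by 40, then translate by (a, b).
  -- Orientations get multiplied by 1/160 and slopes by 1/10.
  shrink : ℚ → ℚ → Point → Point
  shrink a b p = (a + xc p * ¼ , b + yc p * squash)

  lower upper : Point → Point
  lower = shrink 0ℚ 0ℚ
  upper = shrink ¾ ¼

  InSquare : Point → Set
  InSquare p = (0ℚ ≤ xc p) × (0ℚ ≤ 1ℚ - xc p) × (0ℚ ≤ yc p) × (0ℚ ≤ 1ℚ - yc p)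

  -- q lies to the right of p, with slope between -1 and 1.
  Flat : Point → Point → Set
  Flat p q = (0ℚ < xc q - xc p) × (0ℚ ≤ (xc q - xc p) - (yc q - yc p)) × (0ℚ ≤ (xc q - xc p) + (yc q - yc p))

  flat-distinct-x : ∀ p q → Flat p q → xc p ≡ xc q → ⊥
  flat-distinct-x p q flat eq =
    ℚP.<-irrefl refl (subst (0ℚ <_) (trans (cong (xc q -_) eq) (ℚP.+-inverseʳ (xc q))) (proj₁ flat))

  sx sy : ∀ {n} → Polynomial n → Polynomial n → Polynomial n
  sx a x = a :+ x :* con ¼
  sy b y = b :+ y :* con squash

  Det : ∀ {n} → Polynomial n → Polynomial n → Polynomial n → Polynomial n → Polynomial n → Polynomial n → Polynomial n
  Det x₁ y₁ x₂ y₂ x₃ y₃ = ((x₂ :- x₁) :* (y₃ :- y₁)) :- ((y₂ :- y₁) :* (x₃ :- x₁))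

  orient-shrink : ∀ a b p q r → orient (shrink a b p) (shrink a b q) (shrink a b r) ≡ (+ 1 / 160) * orient p q r
  orient-shrink a b (x₁ , y₁) (x₂ , y₂) (x₃ , y₃) = solve 8 (λ a b x₁ y₁ x₂ y₂ x₃ y₃ →
    Det (sx a x₁) (sy b y₁) (sx a x₂) (sy b y₂) (sx a x₃) (sy b y₃) := con (+ 1 / 160) :* Det x₁ y₁ x₂ y₂ x₃ y₃)
    refl a b x₁ y₁ x₂ y₂ x₃ y₃

  square-shrink : ∀ {a b} p → 0ℚ ≤ a → 0ℚ ≤ ¾ - a → 0ℚ ≤ b → 0ℚ ≤ (+ 39 / 40) - b →
                  InSquare p → InSquare (shrink a b p)
  square-shrink {a} {b} (x , y) ha ha' hb hb' (h₁ , h₂ , h₃ , h₄) =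
    0≤+ ha (0≤* h₁ (nonneg! ¼)) ,
    ≤-by (solve 2 (λ a x → con 1ℚ :- sx a x := (con ¾ :- a) :+ (con 1ℚ :- x) :* con ¼) refl a x)
      (0≤+ ha' (0≤* h₂ (nonneg! ¼))) ,
    0≤+ hb (0≤* h₃ (nonneg! squash)) ,
    ≤-by (solve 2 (λ b y → con 1ℚ :- sy b y := (con (+ 39 / 40) :- b) :+ (con 1ℚ :- y) :* con squash) refl b y)
      (0≤+ hb' (0≤* h₄ (nonneg! squash)))

  square-lower : ∀ p → InSquare p → InSquare (lower p)
  square-lower p = square-shrink p (nonneg! 0ℚ) (nonneg! (¾ - 0ℚ)) (nonneg! 0ℚ) (nonneg! ((+ 39 / 40) - 0ℚ))

  square-upper : ∀ p → InSquare p → InSquare (upper p)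
  square-upper p = square-shrink p (nonneg! ¾) (nonneg! (¾ - ¾)) (nonneg! ¼) (nonneg! ((+ 39 / 40) - ¼))

  -- Shrinking divides slopes by 10, so flat pairs stay flat.
  flat-shrink : ∀ a b p q → Flat p q → Flat (shrink a b p) (shrink a b q)
  flat-shrink a b (x₁ , y₁) (x₂ , y₂) (h₁ , h₂ , h₃) =
    <-by (solve 3 (λ a x₁ x₂ → sx a x₂ :- sx a x₁ := (x₂ :- x₁) :* con ¼) refl a x₁ x₂)
      (0<* h₁ (positive! ¼)) ,
    ≤-by (solve 6 (λ a b x₁ y₁ x₂ y₂ → (sx a x₂ :- sx a x₁) :- (sy b y₂ :- sy b y₁)
            := ((x₂ :- x₁) :- (y₂ :- y₁)) :* con squash :+ (x₂ :- x₁) :* con (+ 9 / 40)) refl a b x₁ y₁ x₂ y₂)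
      (0≤+ (0≤* h₂ (nonneg! squash)) (0≤* (ℚP.<⇒≤ h₁) (nonneg! (+ 9 / 40)))) ,
    ≤-by (solve 6 (λ a b x₁ y₁ x₂ y₂ → (sx a x₂ :- sx a x₁) :+ (sy b y₂ :- sy b y₁)
            := ((x₂ :- x₁) :+ (y₂ :- y₁)) :* con squash :+ (x₂ :- x₁) :* con (+ 9 / 40)) refl a b x₁ y₁ x₂ y₂)
      (0≤+ (0≤* h₃ (nonneg! squash)) (0≤* (ℚP.<⇒≤ h₁) (nonneg! (+ 9 / 40))))

  flat-lower-upper : ∀ p q → InSquare p → InSquare q → Flat (lower p) (upper q)
  flat-lower-upper (x₁ , y₁) (x₂ , y₂) (a₁ , a₂ , a₃ , a₄) (b₁ , b₂ , b₃ , b₄) =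
    <-by (solve 2 (λ x₁ x₂ → sx (con ¾) x₂ :- sx (con 0ℚ) x₁ := con ½ :+ (x₂ :* con ¼ :+ (con 1ℚ :- x₁) :* con ¼))
            refl x₁ x₂)
      (0<+ (positive! ½) (0≤+ (0≤* b₁ (nonneg! ¼)) (0≤* a₂ (nonneg! ¼)))) ,
    ≤-by (solve 4 (λ x₁ y₁ x₂ y₂ → (sx (con ¾) x₂ :- sx (con 0ℚ) x₁) :- (sy (con ¼) y₂ :- sy (con 0ℚ) y₁)
            := con (+ 9 / 40) :+ (x₂ :* con ¼ :+ (con 1ℚ :- x₁) :* con ¼ :+ (con 1ℚ :- y₂) :* con squash
                                  :+ y₁ :* con squash)) refl x₁ y₁ x₂ y₂)
      (0≤+ (nonneg! (+ 9 / 40)) (0≤+ (0≤+ (0≤+ (0≤* b₁ (nonneg! ¼)) (0≤* a₂ (nonneg! ¼)))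
        (0≤* b₄ (nonneg! squash))) (0≤* a₃ (nonneg! squash)))) ,
    ≤-by (solve 4 (λ x₁ y₁ x₂ y₂ → (sx (con ¾) x₂ :- sx (con 0ℚ) x₁) :+ (sy (con ¼) y₂ :- sy (con 0ℚ) y₁)
            := con (+ 29 / 40) :+ (x₂ :* con ¼ :+ (con 1ℚ :- x₁) :* con ¼ :+ y₂ :* con squash
                                   :+ (con 1ℚ :- y₁) :* con squash)) refl x₁ y₁ x₂ y₂)
      (0≤+ (nonneg! (+ 29 / 40)) (0≤+ (0≤+ (0≤+ (0≤* b₁ (nonneg! ¼)) (0≤* a₂ (nonneg! ¼)))
        (0≤* b₃ (nonneg! squash))) (0≤* a₄ (nonneg! squash))))

  -- The lower box lies deep below the upper box.  Each orientation is written
  -- as a combination of the (nonnegative) slack quantities of Flat and InSquare.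
  lower-lower-upper : ∀ p q r → Flat p q → InSquare p → InSquare r → CCW (lower p) (lower q) (upper r)
  lower-lower-upper (x₁ , y₁) (x₂ , y₂) (x₃ , y₃) (d , u , v) (a₁ , a₂ , a₃ , a₄) (b₁ , b₂ , b₃ , b₄) =
    <-by (solve 6 (λ x₁ y₁ x₂ y₂ x₃ y₃ →
      Det (sx (con 0ℚ) x₁) (sy (con 0ℚ) y₁) (sx (con 0ℚ) x₂) (sy (con 0ℚ) y₂) (sx (con ¾) x₃) (sy (con ¼) y₃)
      := con (+ 1 / 160) :* (con (+ 5 / 1) :* (x₂ :- x₁)
           :+ ((x₂ :- x₁) :- (y₂ :- y₁)) :* (con (+ 6 / 1) :+ y₃ :+ (con 1ℚ :- y₁) :+ x₃ :+ (con 1ℚ :- x₁)) :* con ½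
           :+ ((x₂ :- x₁) :+ (y₂ :- y₁)) :* (y₃ :+ (con 1ℚ :- y₁) :+ (con 1ℚ :- x₃) :+ x₁) :* con ½))
      refl x₁ y₁ x₂ y₂ x₃ y₃)
    (0<* (positive! (+ 1 / 160)) (0<+ (0<+ (0<* (positive! (+ 5 / 1)) d)
      (0≤* (0≤* u (0≤+ (0≤+ (0≤+ (0≤+ (nonneg! (+ 6 / 1)) b₃) a₄) b₁) a₂)) (nonneg! ½)))
      (0≤* (0≤* v (0≤+ (0≤+ (0≤+ b₃ a₄) b₂) a₁)) (nonneg! ½))))

  upper-upper-lower : ∀ p q r → Flat p q → InSquare p → InSquare r → CW (upper p) (upper q) (lower r)
  upper-upper-lower (x₁ , y₁) (x₂ , y₂) (x₃ , y₃) (d , u , v) (a₁ , a₂ , a₃ , a₄) (b₁ , b₂ , b₃ , b₄) =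
    subst (_< 0ℚ) (sym (solve 6 (λ x₁ y₁ x₂ y₂ x₃ y₃ →
      Det (sx (con ¾) x₁) (sy (con ¼) y₁) (sx (con ¾) x₂) (sy (con ¼) y₂) (sx (con 0ℚ) x₃) (sy (con 0ℚ) y₃)
      := :- (con (+ 1 / 160) :* (con (+ 5 / 1) :* (x₂ :- x₁)
           :+ ((x₂ :- x₁) :- (y₂ :- y₁)) :* (con (+ 6 / 1) :+ (con 1ℚ :- y₃) :+ y₁ :+ (con 1ℚ :- x₃) :+ x₁) :* con ½
           :+ ((x₂ :- x₁) :+ (y₂ :- y₁)) :* ((con 1ℚ :- y₃) :+ y₁ :+ x₃ :+ (con 1ℚ :- x₁)) :* con ½)))
      refl x₁ y₁ x₂ y₂ x₃ y₃))
    (ℚP.neg-antimono-< (0<* (positive! (+ 1 / 160)) (0<+ (0<+ (0<* (positive! (+ 5 / 1)) d)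
      (0≤* (0≤* u (0≤+ (0≤+ (0≤+ (0≤+ (nonneg! (+ 6 / 1)) b₄) a₃) b₂) a₁)) (nonneg! ½)))
      (0≤* (0≤* v (0≤+ (0≤+ (0≤+ b₄ a₃) b₁) a₂)) (nonneg! ½)))))


module TreePicture where

  open Trees
  open Orientation
  open Realisation
  open Shrinking
  open import Data.Nat as ℕ using (ℕ; zero)
  import Data.Nat.Properties as ℕP
  open import Data.Fin as F using (Fin; zero; toℕ; _↑ˡ_; _↑ʳ_; splitAt)
  import Data.Fin.Properties as FP
  open import Data.Rational using (0ℚ; _/_)
  open import Data.Integer using (+_)
  open import Data.Product using (_,_)
  open import Data.Sum using (_⊎_; inj₁; inj₂; [_,_]′)
  open import Data.Empty using (⊥-elim)
  open import Function using (id)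
  open import Relation.Nullary using (¬_)
  open import Relation.Binary.PropositionalEquality using (_≡_; refl; sym; trans; cong; subst)

  picture : ∀ {t} → Leaf t → Point
  picture stop    = (0ℚ , 0ℚ)
  picture (goL x) = lower (picture x)
  picture (goR x) = upper (picture x)

  picture-inSquare : ∀ {t} (x : Leaf t) → InSquare (picture x)
  picture-inSquare stop    = nonneg! 0ℚ , nonneg! _ , nonneg! 0ℚ , nonneg! _
  picture-inSquare (goL x) = square-lower (picture x) (picture-inSquare x)
  picture-inSquare (goR x) = square-upper (picture x) (picture-inSquare x)

  picture-flat : ∀ {t} (a b : Leaf t) → ord a b ≡ pos → Flat (picture a) (picture b)
  picture-flat stop    stop    ()
  picture-flat (goR a) (goL b) ()
  picture-flat (goL a) (goL b) e = flat-shrink 0ℚ 0ℚ (picture a) (picture b) (picture-flat a b e)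
  picture-flat (goR a) (goR b) e = flat-shrink ¾ ¼ (picture a) (picture b) (picture-flat a b e)
  picture-flat (goL a) (goR b) e = flat-lower-upper (picture a) (picture b) (picture-inSquare a) (picture-inSquare b)

  -- Induction on t: the two shrunk pictures realise the subtrees, and the lower
  -- box lies deep below the upper one, so their union realises node l r.
  picture-realises : ∀ t → Realises {Leaf t} id picture
  picture-realises leaf       = realises-point id picture λ { stop stop → refl }
  picture-realises (node l r) =
    realises-reindex unglue (λ { (goL _) → refl ; (goR _) → refl }) (λ { (goL _) → refl ; (goR _) → refl })
      (realises-glue (realises-scale lower (positive! (+ 1 / 160)) (orient-shrink 0ℚ 0ℚ) (picture-realises l))
                     (realises-scale upper (positive! (+ 1 / 160)) (orient-shrink ¾ ¼) (picture-realises r))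
                     (lowerBelow , upperAbove))
    where
    unglue : Leaf (node l r) → Leaf l ⊎ Leaf r
    unglue (goL x) = inj₁ x
    unglue (goR x) = inj₂ x
    lowerBelow : ∀ a a' c → ord a a' ≡ pos → CCW (lower (picture a)) (lower (picture a')) (upper (picture c))
    lowerBelow a a' c e =
      lower-lower-upper (picture a) (picture a') (picture c) (picture-flat a a' e) (picture-inSquare a) (picture-inSquare c)
    upperAbove : ∀ b b' a → ord b b' ≡ pos → CW (upper (picture b)) (upper (picture b')) (lower (picture a))
    upperAbove b b' a e =
      upper-upper-lower (picture b) (picture b') (picture a) (picture-flat b b' e) (picture-inSquare b) (picture-inSquare a)

  picture-x-injective : ∀ {t} (x y : Leaf t) → xc (picture x) ≡ xc (picture y) → x ≡ y
  picture-x-injective x y eq = bySign (ord x y) refl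
    where
    bySign : ∀ s → ord x y ≡ s → x ≡ y
    bySign pos e = ⊥-elim (flat-distinct-x (picture x) (picture y) (picture-flat x y e) eq)
    bySign neg e = ⊥-elim (flat-distinct-x (picture y) (picture x) (picture-flat y x (trans (ord-anti x y) (cong negS e))) (sym eq))
    bySign zer e = ord-zer x y e

  leafCount : Tree → ℕ
  leafCount leaf       = 1
  leafCount (node l r) = leafCount l ℕ.+ leafCount r

  toF : ∀ {t} → Leaf t → Fin (leafCount t)
  toF stop                = zero
  toF {node l r} (goL x) = toF x ↑ˡ leafCount r
  toF {node l r} (goR x) = leafCount l ↑ʳ toF x

  fromF : ∀ {t} → Fin (leafCount t) → Leaf t
  fromF {leaf}     _ = stop
  fromF {node l r} i = [ (λ j → goL (fromF j)) , (λ j → goR (fromF j)) ]′ (splitAt (leafCount l) i)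

  joined : ∀ {m n} {i : Fin (m ℕ.+ n)} {s} → splitAt m i ≡ s → F.join m n s ≡ i
  joined {m} {n} {i} eq = trans (sym (cong (F.join m n) eq)) (FP.join-splitAt m n i)

  fromF-toF : ∀ {t} (x : Leaf t) → fromF (toF x) ≡ x
  fromF-toF stop = refl
  fromF-toF {node l r} (goL x) rewrite FP.splitAt-↑ˡ (leafCount l) (toF x) (leafCount r) = cong goL (fromF-toF x)
  fromF-toF {node l r} (goR x) rewrite FP.splitAt-↑ʳ (leafCount l) (leafCount r) (toF x) = cong goR (fromF-toF x)

  toF-fromF : ∀ {t} (i : Fin (leafCount t)) → toF {t} (fromF i) ≡ i
  toF-fromF {leaf} zero = refl
  toF-fromF {node l r} i with splitAt (leafCount l) i in eq
  ... | inj₁ j = trans (cong (_↑ˡ leafCount r) (toF-fromF {l} j)) (joined eq)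
  ... | inj₂ j = trans (cong (leafCount l ↑ʳ_) (toF-fromF {r} j)) (joined eq)

  fromF-injective : ∀ {t} (i j : Fin (leafCount t)) → fromF {t} i ≡ fromF j → i ≡ j
  fromF-injective {t} i j e = trans (sym (toF-fromF {t} i)) (trans (cong toF e) (toF-fromF {t} j))

  toF-injective : ∀ {t} {x y : Leaf t} → toF x ≡ toF y → x ≡ y
  toF-injective {x = x} {y} e = trans (sym (fromF-toF x)) (trans (cong fromF e) (fromF-toF y))

  toF-order : ∀ {t} (a b : Leaf t) → toℕ (toF a) ℕ.< toℕ (toF b) → ord a b ≡ pos
  toF-order stop stop lt = ⊥-elim (ℕP.<-irrefl refl lt)
  toF-order {node l r} (goL a) (goL b) lt
    rewrite FP.toℕ-↑ˡ (toF a) (leafCount r) | FP.toℕ-↑ˡ (toF b) (leafCount r) = toF-order a b lt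
  toF-order {node l r} (goR a) (goR b) lt
    rewrite FP.toℕ-↑ʳ (leafCount l) (toF a) | FP.toℕ-↑ʳ (leafCount l) (toF b) =
    toF-order a b (ℕP.+-cancelˡ-< (leafCount l) _ _ lt)
  toF-order (goL a) (goR b) lt = refl
  toF-order {node l r} (goR a) (goL b) lt
    rewrite FP.toℕ-↑ʳ (leafCount l) (toF a) | FP.toℕ-↑ˡ (toF b) (leafCount r) =
    ⊥-elim (ℕP.<-irrefl refl (ℕP.≤-<-trans (ℕP.m≤m+n (leafCount l) (toℕ (toF a)))
                                (ℕP.<-trans lt (FP.toℕ<n (toF b)))))

  -- The picture of t as a point set: distinct x-coordinates because pictures
  -- of leaves in left-to-right order are flat pairs, general position because
  -- only degenerate leaf triples have combinatorial orientation zero.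
  drawing : Tree → PointSet
  drawing t = record
    { size = leafCount t
    ; pt = λ i → picture (fromF {t} i)
    ; distinctX = λ i j eq → fromF-injective {t} i j (picture-x-injective _ _ eq)
    ; generalPosition = inGeneralPosition }
    where
    inGeneralPosition : ∀ i j m → ¬ i ≡ j → ¬ j ≡ m → ¬ i ≡ m →
      ¬ orient (picture (fromF {t} i)) (picture (fromF {t} j)) (picture (fromF {t} m)) ≡ 0ℚ
    inGeneralPosition i j m i≢j j≢m i≢m o≡0
      with σ-zer (fromF i) (fromF j) (fromF m)
             (Sgn-zero _ (subst (Sgn _) o≡0 (agrees (picture-realises t) (fromF i) (fromF j) (fromF m))))
    ... | inj₁ e        = i≢j (fromF-injective {t} i j e)
    ... | inj₂ (inj₁ e) = j≢m (fromF-injective {t} j m e)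
    ... | inj₂ (inj₂ e) = i≢m (fromF-injective {t} i m e)

  drawing-agrees : ∀ {t} (x y z : Leaf t) →
    Agrees x y z (pt (drawing t) (toF x)) (pt (drawing t) (toF y)) (pt (drawing t) (toF z))
  drawing-agrees {t} x y z rewrite fromF-toF x | fromF-toF y | fromF-toF z = agrees (picture-realises t) x y z


module SubsetSize where

  open import Data.Nat using (pred)
  open import Data.Bool using (true; false)
  open import Data.Fin using (suc)
  open import Data.Fin.Subset using (Subset; _∈_; ∣_∣)
  open import Data.Vec using (_∷_; here; there)
  open import Data.Empty using (⊥; ⊥-elim)
  open import Relation.Binary.PropositionalEquality using (_≡_; refl; cong)

  size-zero-empty : ∀ {n} (S : Subset n) {x} → ∣ S ∣ ≡ 0 → x ∈ S → ⊥
  size-zero-empty (true ∷ S)  ()  _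
  size-zero-empty (false ∷ S) eq (there m) = size-zero-empty S eq m

  size-one-unique : ∀ {n} (S : Subset n) {x y} → ∣ S ∣ ≡ 1 → x ∈ S → y ∈ S → x ≡ y
  size-one-unique (true ∷ S)  eq here      here       = refl
  size-one-unique (true ∷ S)  eq here      (there m)  = ⊥-elim (size-zero-empty S (cong pred eq) m)
  size-one-unique (true ∷ S)  eq (there m) _          = ⊥-elim (size-zero-empty S (cong pred eq) m)
  size-one-unique (false ∷ S) eq (there m) (there m') = cong suc (size-one-unique S eq m m')



module DecompositionTree (Q : PointSet) where

  open Trees
  open Realisation
  open SubsetSize using (size-one-unique)
  open import Data.Fin using (Fin)
  open import Data.Fin.Subset using (Subset; _∈_; _∪_)
  open import Data.Fin.Subset.Properties using (x∈p∪q⁻)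
  open import Data.Rational using (_<_)
  open import Data.Product using (Σ; _,_; proj₁; proj₂)
  open import Data.Sum as Sum using (_⊎_; inj₁; inj₂)
  open import Relation.Binary.PropositionalEquality using (_≡_; refl; sym; cong; subst; subst₂)

  Elem : Subset (size Q) → Set
  Elem S = Σ (Fin (size Q)) (_∈ S)

  point : ∀ {S} → Elem S → Point
  point u = pt Q (proj₁ u)

  classify : ∀ {S₁ S₂ S} → S₁ ∪ S₂ ≡ S → Elem S → Elem S₁ ⊎ Elem S₂
  classify {S₁} {S₂} eq (i , i∈S) = Sum.map (i ,_) (i ,_) (x∈p∪q⁻ S₁ S₂ (subst (i ∈_) (sym eq) i∈S))

  point-classify : ∀ {S₁ S₂ S} (eq : S₁ ∪ S₂ ≡ S) u → gluePoint point point (classify eq u) ≡ point u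
  point-classify {S₁} {S₂} eq (i , i∈S) = keepsIndex (x∈p∪q⁻ S₁ S₂ (subst (i ∈_) (sym eq) i∈S))
    where
    keepsIndex : (s : i ∈ S₁ ⊎ i ∈ S₂) → gluePoint point point (Sum.map (i ,_) (i ,_) s) ≡ pt Q i
    keepsIndex (inj₁ _) = refl
    keepsIndex (inj₂ _) = refl

  shape : ∀ {S} → DecomposableSub Q S → Tree
  shape (single _ _)                     = leaf
  shape (split _ _ _ _ _ _ _ _ d₁ d₂) = node (shape d₁) (shape d₂)

  leafOf : ∀ {S} (d : DecomposableSub Q S) → Elem S → Leaf (shape d)
  leafOf (single _ _)                      _ = stop
  leafOf (split _ _ _ _ _ eq _ _ d₁ d₂) u = glueLeaf (leafOf d₁) (leafOf d₂) (classify eq u)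

  leafOf-x-monotone : ∀ {S} (d : DecomposableSub Q S) u v →
    ord (leafOf d u) (leafOf d v) ≡ pos → xc (point u) < xc (point v)
  leafOf-x-monotone (single _ _) u v ()
  leafOf-x-monotone (split _ _ _ _ _ eq before _ d₁ d₂) u v e =
    subst₂ (λ p q → xc p < xc q) (point-classify eq u) (point-classify eq v) (glued (classify eq u) (classify eq v) e)
    where
    glued : ∀ a b → ord (glueLeaf (leafOf d₁) (leafOf d₂) a) (glueLeaf (leafOf d₁) (leafOf d₂) b) ≡ pos →
            xc (gluePoint point point a) < xc (gluePoint point point b)
    glued (inj₁ a) (inj₁ b) e = leafOf-x-monotone d₁ a b e
    glued (inj₂ a) (inj₂ b) e = leafOf-x-monotone d₂ a b e
    glued (inj₁ a) (inj₂ b) _ = before (proj₁ a) (proj₁ b) (proj₂ a) (proj₂ b)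
    glued (inj₂ a) (inj₁ b) ()

  leafOf-realises : ∀ {S} (d : DecomposableSub Q S) → Realises (leafOf d) point
  leafOf-realises (single S one) =
    realises-point _ point λ u v → cong (pt Q) (size-one-unique S one (proj₂ u) (proj₂ v))
  leafOf-realises (split _ _ _ _ _ eq _ deep d₁ d₂) =
    realises-reindex (classify eq) (λ _ → refl) (λ u → sym (point-classify eq u))
      (realises-glue (leafOf-realises d₁) (leafOf-realises d₂) (above , below))
    where
    above : ∀ u u' v → ord (leafOf d₁ u) (leafOf d₁ u') ≡ pos → CCW (point u) (point u') (point v)
    above u u' v e = proj₁ deep (proj₁ u) (proj₁ u') (proj₁ v) (proj₂ u) (proj₂ u')
                       (leafOf-x-monotone d₁ u u' e) (proj₂ v)
    below : ∀ v v' u → ord (leafOf d₂ v) (leafOf d₂ v') ≡ pos → CW (point v) (point v') (point u)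
    below v v' u e = proj₂ deep (proj₁ v) (proj₁ v') (proj₁ u) (proj₂ v) (proj₂ v')
                       (leafOf-x-monotone d₂ v v' e) (proj₂ u)

  leafOf-injective : ∀ {S} (d : DecomposableSub Q S) {u v} → leafOf d u ≡ leafOf d v → proj₁ u ≡ proj₁ v
  leafOf-injective d {u} {v} e =
    distinctX Q (proj₁ u) (proj₁ v) (cong xc (faithful (leafOf-realises d) u v (≡⇒ord-zer e)))


open import Data.Nat using (ℕ; _≤_)
open import Data.Fin using (Fin; toℕ)
open import Data.Product using (Σ; _×_; _,_; proj₁; proj₂)

open Trees
open TreeRamsey using (pairRamsey)
open Orientation using (Sgn; same-sign-⇔)
open Realisation using (agrees)
open TreePicture using (drawing; drawing-agrees; toF; toF-injective; toF-order)
open import Data.Nat as ℕ using ()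
open import Data.Fin.Subset.Properties using (∈⊤)
open import Data.Rational using (ℚ)
open import Function.Bundles using (_⇔_)
open import Relation.Binary.PropositionalEquality using (_≡_; sym; trans; subst)

-- Draw a tree U that is Ramsey for pairs of leaves of the shape s of Q.  A
-- colouring of pairs of the drawing is a colouring of pairs of leaves of U; a
-- monochromatic copy F of s gives the embedding i ↦ F(leaf of i), which
-- preserves orientations since both Q and the drawing realise σ.
theorem2 : (k : ℕ) → 1 ≤ k → (Q : PointSet) → Decomposable Q →
    Σ PointSet λ P → (c : PairColoring k P) →
      Σ (Fin (size Q) → Fin (size P)) λ g → SameOrderTypeVia Q P g × Monochromatic P c g
theorem2 k _ Q dQ = drawing U , monochromaticCopy
  where
  open DecompositionTree Q
  q : Fin (size Q) → Leaf (shape dQ)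
  q i = leafOf dQ (i , ∈⊤)
  U : Tree
  U = proj₁ (pairRamsey k (shape dQ))
  P : PointSet
  P = drawing U
  monochromaticCopy : (c : PairColoring k P) →
    Σ (Fin (size Q) → Fin (size P)) λ g → SameOrderTypeVia Q P g × Monochromatic P c g
  monochromaticCopy c with proj₂ (pairRamsey k (shape dQ)) (λ x y → c (toF x) (toF y))
  ... | a , F , sameColour = g , (injective , sameOrientation) , a , monochromatic
    where
    g : Fin (size Q) → Fin (size P)
    g i = toF (F ∘E q i)
    injective : ∀ {i j} → g i ≡ g j → i ≡ j
    injective e = leafOf-injective dQ (∘E-injective F (toF-injective e))
    sameOrientation : ∀ i j l →
      (CCW (pt Q i) (pt Q j) (pt Q l) ⇔ CCW (pt P (g i)) (pt P (g j)) (pt P (g l))) ×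
      (CW (pt Q i) (pt Q j) (pt Q l) ⇔ CW (pt P (g i)) (pt P (g j)) (pt P (g l)))
    sameOrientation i j l =
      same-sign-⇔ (σ (q i) (q j) (q l)) {inQ} {inP}
        (agrees (leafOf-realises dQ) (i , ∈⊤) (j , ∈⊤) (l , ∈⊤))
        (subst (λ s → Sgn s inP) (σ-emb F (q i) (q j) (q l)) (drawing-agrees (F ∘E q i) (F ∘E q j) (F ∘E q l)))
      where
      inQ inP : ℚ
      inQ = orient (pt Q i) (pt Q j) (pt Q l)
      inP = orient (pt P (g i)) (pt P (g j)) (pt P (g l))
    monochromatic : ∀ i j → toℕ (g i) ℕ.< toℕ (g j) → c (g i) (g j) ≡ a
    monochromatic i j lt =
      sameColour (proj₂ (ord-sep (q i) (q j) (trans (sym (ord-emb F (q i) (q j))) (toF-order (F ∘E q i) (F ∘E q j) lt))))
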